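{- Let $n,k$ be positive integers with $n\ge 3k$, and let $\mathcal{F}\subset\binom{[n]}{k}$ be an intersecting family with $|\mathcal{F}|\le \binom{n-1}{k-1}/(2k)$. Then $$|\mathcal{D}(\mathcal{F})| \le \sum_{0\le \ell<k}\binom{n-1}{\ell}.$$
   Context: $[n]=\{1,\dots,n\}$ and $\binom{[n]}{k}$ is the family of all $k$-element subsets of $[n]$. A family $\mathcal{F}$ is intersecting if $F\cap F'\neq\varnothing$ for all $F,F'\in\mathcal{F}$. For a family $\mathcal{F}$, $\mathcal{D}(\mathcal{F}) := \{F\setminus F' : F,F'\in\mathcal{F}\}$ is the family of setwise differences. -}

module Defs where

open import Data.Nat using (ℕ; zero; suc; _+_)
open import Data.Nat.Combinatorics using (_C_)
open import Data.List using (List; length; deduplicate; concatMap; map)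
open import Data.List.Relation.Unary.All using (All)
open import Data.List.Relation.Unary.Unique.Propositional using (Unique)
open import Data.List.Membership.Propositional using (_∈_)
open import Data.Fin.Subset using (Subset; _─_; _∩_; Nonempty; ∣_∣)
open import Data.Bool using (_≟_)
open import Data.Vec.Properties using (≡-dec)
open import Relation.Binary.PropositionalEquality using (_≡_)

-- A family of subsets of [n] = Fin n, given as a duplicate-free list.
Family : ℕ → Set
Family n = List (Subset n)

IsUniform : ∀ {n} → ℕ → Family n → Set
IsUniform k 𝓕 = All (λ F → ∣ F ∣ ≡ k) 𝓕

IsIntersecting : ∀ {n} → Family n → Set
IsIntersecting 𝓕 = ∀ {F G} → F ∈ 𝓕 → G ∈ 𝓕 → Nonempty (F ∩ G)

D : ∀ {n} → Family n → List (Subset n)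
D 𝓕 = deduplicate (≡-dec _≟_) (concatMap (λ F → map (λ G → F ─ G) 𝓕) 𝓕)

sumBelow : ℕ → (ℕ → ℕ) → ℕ
sumBelow zero    f = 0
sumBelow (suc k) f = sumBelow k f + f k

-- Every F ─ G lies in F and, 𝓕 being intersecting, has fewer than k elements. The members of D(𝓕)
-- of size k-1 are therefore (k-1)-subsets of members of 𝓕, at most k|𝓕| ≤ C(n-1,k-1)/2 of them,
-- and the smaller ones number at most Σ_{ℓ<k-1} C(n,ℓ). By Pascal's rule this sum is
-- Σ_{ℓ<k-1} C(n-1,ℓ) + Σ_{ℓ<k-2} C(n-1,ℓ), and as n ≥ 3k the coefficients C(n-1,ℓ), ℓ < k, at least
-- double at each step, so the second sum is at most C(n-1,k-2) ≤ C(n-1,k-1)/2.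
module Submission where

open import Defs
open import Data.Nat using (ℕ; zero; suc; _+_; _*_; _≤_; _<_; _∸_; z≤n; s≤s; s≤s⁻¹; _≟_)
open import Data.Nat.Properties
open import Data.Nat.Combinatorics using (_C_; nC1≡n; nCk≡nC[n∸k]; nCk+nC[k+1]≡[n+1]C[k+1])
open import Data.Nat.Tactic.RingSolver using (solve-∀)
open import Data.Bool using () renaming (_≟_ to _≟ᵇ_)
open import Data.Vec using ([]; _∷_) renaming (here to hereᵥ)
open import Data.Vec.Properties using (≡-dec)
open import Data.List using (List; []; _∷_; length; filter)
open import Data.List.Relation.Unary.All using (All; []; _∷_)
import Data.List.Relation.Unary.All as All
import Data.List.Relation.Unary.All.Properties as All
open import Data.List.Relation.Unary.Any using (Any; here; there)
import Data.List.Relation.Unary.Any as Any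
open import Data.List.Relation.Unary.AllPairs using ([]; _∷_)
open import Data.List.Relation.Unary.Unique.Propositional using (Unique)
import Data.List.Relation.Unary.Unique.Propositional.Properties as Unique
open import Data.List.Relation.Unary.Unique.DecPropositional.Properties using (deduplicate-!)
open import Data.List.Membership.Propositional using (_∈_)
open import Data.Fin.Subset using (Subset; Side; inside; outside; _⊆_; _─_; ∣_∣)
open import Data.Fin.Subset.Properties using (_⊆?_; drop-∷-⊆; p─q⊆p; p∩q≢∅⇒∣p─q∣<∣p∣)
open import Data.Product using (_×_; _,_)
open import Data.Empty using (⊥)
open import Function using (_∘_; case_of_)
open import Relation.Nullary using (¬_; ¬?; yes; no; _×-dec_; contradiction)
open import Relation.Unary using (Pred; Decidable)
open import Relation.Binary.PropositionalEquality using (_≡_; refl; sym; trans; cong; cong₂; subst; module ≡-Reasoning)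

[1+k]*nC[1+k]+k*nCk≡n*nCk : ∀ n k → suc k * (n C suc k) + k * (n C k) ≡ n * (n C k)
[1+k]*nC[1+k]+k*nCk≡n*nCk zero    zero    = refl
[1+k]*nC[1+k]+k*nCk≡n*nCk zero    (suc k) = cong₂ _+_ (*-zeroʳ (suc (suc k))) (*-zeroʳ (suc k))
[1+k]*nC[1+k]+k*nCk≡n*nCk (suc n) zero    = begin
  1 * (suc n C 1) + 0 ≡⟨ +-identityʳ _ ⟩
  1 * (suc n C 1)     ≡⟨ *-identityˡ _ ⟩
  suc n C 1           ≡⟨ nC1≡n (suc n) ⟩
  suc n               ≡⟨ *-identityʳ (suc n) ⟨
  suc n * 1           ∎
  where open ≡-Reasoning
[1+k]*nC[1+k]+k*nCk≡n*nCk (suc n) (suc k) = begin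
  suc (suc k) * (suc n C suc (suc k)) + suc k * (suc n C suc k)
    ≡⟨ cong₂ (λ x y → suc (suc k) * x + suc k * y) (pascal (suc k)) (pascal k) ⟨
  suc (suc k) * (b + c) + suc k * (a + b)
    ≡⟨ regroup k a b c ⟩
  (a + b) + ((suc k * b + k * a) + (suc (suc k) * c + suc k * b))
    ≡⟨ cong₂ (λ x y → (a + b) + (x + y)) ([1+k]*nC[1+k]+k*nCk≡n*nCk n k) ([1+k]*nC[1+k]+k*nCk≡n*nCk n (suc k)) ⟩
  (a + b) + (n * a + n * b)
    ≡⟨ distrib n a b ⟩
  suc n * (a + b)
    ≡⟨ cong (suc n *_) (pascal k) ⟩
  suc n * (suc n C suc k) ∎
  where
  open ≡-Reasoning
  pascal : ∀ j → n C j + n C suc j ≡ suc n C suc j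
  pascal = nCk+nC[k+1]≡[n+1]C[k+1] n
  a = n C k
  b = n C suc k
  c = n C suc (suc k)
  regroup : ∀ k a b c → suc (suc k) * (b + c) + suc k * (a + b)
                      ≡ (a + b) + ((suc k * b + k * a) + (suc (suc k) * c + suc k * b))
  regroup = solve-∀
  distrib : ∀ n a b → (a + b) + (n * a + n * b) ≡ suc n * (a + b)
  distrib = solve-∀

-- Since (k+1) C(n,k+1) = (n-k) C(n,k), the ratio C(n,k+1) / C(n,k) is at least 2 once n ≥ 3k + 2.
2*nCk≤nC[1+k] : ∀ n k → 3 * suc k ≤ suc n → 2 * (n C k) ≤ n C suc k
2*nCk≤nC[1+k] n k 3[1+k]≤1+n = *-cancelˡ-≤ (suc k) (+-cancelʳ-≤ (k * x) _ _ (begin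
    suc k * (2 * x) + k * x ≡⟨ collect k x ⟩
    (3 * k + 2) * x         ≤⟨ *-monoˡ-≤ x 3k+2≤n ⟩
    n * x                   ≡⟨ [1+k]*nC[1+k]+k*nCk≡n*nCk n k ⟨
    suc k * (n C suc k) + k * x ∎))
  where
  open ≤-Reasoning
  x = n C k
  collect : ∀ k x → suc k * (2 * x) + k * x ≡ (3 * k + 2) * x
  collect = solve-∀
  3[1+k]≡1+[3k+2] : ∀ k → 3 * suc k ≡ suc (3 * k + 2)
  3[1+k]≡1+[3k+2] = solve-∀
  3k+2≤n : 3 * k + 2 ≤ n
  3k+2≤n = s≤s⁻¹ (subst (_≤ suc n) (3[1+k]≡1+[3k+2] k) 3[1+k]≤1+n)

sumBelow-geometric : ∀ (f : ℕ → ℕ) j → (∀ ℓ → ℓ < j → 2 * f ℓ ≤ f (suc ℓ)) → sumBelow j f ≤ f j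
sumBelow-geometric f zero    _     = z≤n
sumBelow-geometric f (suc j) ratio = begin
  sumBelow j f + f j ≤⟨ +-monoˡ-≤ (f j) (sumBelow-geometric f j (λ ℓ ℓ<j → ratio ℓ (m<n⇒m<1+n ℓ<j))) ⟩
  f j + f j          ≡⟨ cong (f j +_) (+-identityʳ (f j)) ⟨
  2 * f j            ≤⟨ ratio j ≤-refl ⟩
  f (suc j)          ∎
  where open ≤-Reasoning

sumBelow-pascal : ∀ n j → sumBelow (suc j) (suc n C_) ≡ sumBelow (suc j) (n C_) + sumBelow j (n C_)
sumBelow-pascal n zero    = refl
sumBelow-pascal n (suc j) = begin
  sumBelow (suc j) (suc n C_) + suc n C suc j
    ≡⟨ cong₂ _+_ (sumBelow-pascal n j) (sym (nCk+nC[k+1]≡[n+1]C[k+1] n j)) ⟩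
  (sumBelow (suc j) (n C_) + sumBelow j (n C_)) + (n C j + n C suc j)
    ≡⟨ interchange (sumBelow (suc j) (n C_)) (sumBelow j (n C_)) (n C j) (n C suc j) ⟩
  (sumBelow (suc j) (n C_) + n C suc j) + (sumBelow j (n C_) + n C j) ∎
  where
  open ≡-Reasoning
  interchange : ∀ p q r s → (p + q) + (r + s) ≡ (p + s) + (q + r)
  interchange = solve-∀

f0≤sumBelow[1+j]f : ∀ (f : ℕ → ℕ) j → f 0 ≤ sumBelow (suc j) f
f0≤sumBelow[1+j]f f zero    = ≤-refl
f0≤sumBelow[1+j]f f (suc j) = ≤-trans (f0≤sumBelow[1+j]f f j) (m≤m+n _ _)

2*sumBelow[1+n]C≤2*sumBelow[n]C+nCk : ∀ n k → 3 * k ≤ suc n →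
  2 * sumBelow k (suc n C_) ≤ 2 * sumBelow k (n C_) + n C k
2*sumBelow[1+n]C≤2*sumBelow[n]C+nCk n zero    _        = z≤n
2*sumBelow[1+n]C≤2*sumBelow[n]C+nCk n (suc j) 3k≤1+n = begin
  2 * sumBelow (suc j) (suc n C_)               ≡⟨ cong (2 *_) (sumBelow-pascal n j) ⟩
  2 * (sumBelow (suc j) (n C_) + sumBelow j (n C_)) ≡⟨ *-distribˡ-+ 2 (sumBelow (suc j) (n C_)) _ ⟩
  2 * sumBelow (suc j) (n C_) + 2 * sumBelow j (n C_)
    ≤⟨ +-monoʳ-≤ (2 * sumBelow (suc j) (n C_)) (≤-trans (*-monoʳ-≤ 2 below-j) ratio-j) ⟩
  2 * sumBelow (suc j) (n C_) + n C suc j       ∎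
  where
  open ≤-Reasoning
  ratio : ∀ ℓ → ℓ ≤ j → 2 * (n C ℓ) ≤ n C suc ℓ
  ratio ℓ ℓ≤j = 2*nCk≤nC[1+k] n ℓ (≤-trans (*-monoʳ-≤ 3 (s≤s ℓ≤j)) 3k≤1+n)
  below-j : sumBelow j (n C_) ≤ n C j
  below-j = sumBelow-geometric (n C_) j (λ ℓ ℓ<j → ratio ℓ (<⇒≤ ℓ<j))
  ratio-j : 2 * (n C j) ≤ n C suc j
  ratio-j = ratio j ≤-refl

m*[1+k]+sumBelow[k][1+n]C≤sumBelow[1+k][n]C : ∀ n k m → 3 * suc k ≤ suc n → 2 * suc k * m ≤ n C k →
  m * suc k + sumBelow k (suc n C_) ≤ sumBelow (suc k) (n C_)
m*[1+k]+sumBelow[k][1+n]C≤sumBelow[1+k][n]C n k m 3[1+k]≤1+n 2[1+k]m≤nCk = *-cancelˡ-≤ 2 (begin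
  2 * (m * suc k + T)       ≡⟨ *-distribˡ-+ 2 (m * suc k) T ⟩
  2 * (m * suc k) + 2 * T   ≤⟨ +-mono-≤ (≤-trans (≤-reflexive (reorder k m)) 2[1+k]m≤nCk)
                                        (2*sumBelow[1+n]C≤2*sumBelow[n]C+nCk n k (≤-trans (*-monoʳ-≤ 3 (n≤1+n k)) 3[1+k]≤1+n)) ⟩
  n C k + (2 * S + n C k)   ≡⟨ collect (n C k) S ⟩
  2 * (S + n C k)           ∎)
  where
  open ≤-Reasoning
  S = sumBelow k (n C_)
  T = sumBelow k (suc n C_)
  reorder : ∀ k m → 2 * (m * suc k) ≡ 2 * suc k * m
  reorder = solve-∀
  collect : ∀ c s → c + (2 * s + c) ≡ 2 * (s + c)
  collect = solve-∀

length≡length-filter+length-filter-¬ : ∀ {a p} {A : Set a} {P : Pred A p} (P? : Decidable P) (xs : List A) →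
  length xs ≡ length (filter P? xs) + length (filter (¬? ∘ P?) xs)
length≡length-filter+length-filter-¬ P? []       = refl
length≡length-filter+length-filter-¬ P? (x ∷ xs) with P? x
... | yes _ = cong suc (length≡length-filter+length-filter-¬ P? xs)
... | no  _ = trans (cong suc (length≡length-filter+length-filter-¬ P? xs)) (sym (+-suc _ _))

length≤length*bound : ∀ {a b p} {A : Set a} {B : Set b} {P : B → Pred A p} → (∀ y → Decidable (P y)) →
  (ys : List B) (c : ℕ) → (∀ {y} → y ∈ ys → ∀ {xs} → Unique xs → All (P y) xs → length xs ≤ c) →
  ∀ {xs} → Unique xs → All (λ x → Any (λ y → P y x) ys) xs → length xs ≤ length ys * c
length≤length*bound P? []       c bound {[]}    _ _        = z≤n
length≤length*bound P? []       c bound {_ ∷ _} _ (() ∷ _)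
length≤length*bound P? (y ∷ ys) c bound {xs} !xs covered = begin
  length xs                                                        ≡⟨ length≡length-filter+length-filter-¬ (P? y) xs ⟩
  length (filter (P? y) xs) + length (filter (¬? ∘ P? y) xs)
    ≤⟨ +-mono-≤ (bound (here refl) (Unique.filter⁺ (P? y) !xs) (All.all-filter (P? y) xs))
                (length≤length*bound P? ys c (bound ∘ there) (Unique.filter⁺ (¬? ∘ P? y) !xs)
                  (All.zipWith (λ (¬Pyx , any) → Any.tail ¬Pyx any)
                    (All.all-filter (¬? ∘ P? y) xs , All.filter⁺ (¬? ∘ P? y) covered))) ⟩
  c + length ys * c                                                ∎
  where open ≤-Reasoning

tailsWithHead : ∀ {n} → Side → List (Subset (suc n)) → List (Subset n)
tailsWithHead s []             = []
tailsWithHead s ((x ∷ p) ∷ ps) with x ≟ᵇ s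
... | yes _ = p ∷ tailsWithHead s ps
... | no  _ = tailsWithHead s ps

length≡length-tailsWithHead : ∀ {n} (ps : List (Subset (suc n))) →
  length ps ≡ length (tailsWithHead outside ps) + length (tailsWithHead inside ps)
length≡length-tailsWithHead []                   = refl
length≡length-tailsWithHead ((outside ∷ p) ∷ ps) = cong suc (length≡length-tailsWithHead ps)
length≡length-tailsWithHead ((inside  ∷ p) ∷ ps) =
  trans (cong suc (length≡length-tailsWithHead ps)) (sym (+-suc _ _))

All-tailsWithHead : ∀ {n s ℓ ℓ′} {P : Pred (Subset (suc n)) ℓ} {Q : Pred (Subset n) ℓ′} →
  (∀ p → P (s ∷ p) → Q p) → ∀ {ps} → All P ps → All Q (tailsWithHead s ps)
All-tailsWithHead     f []                      = []
All-tailsWithHead {s = s} f {(x ∷ p) ∷ _} (Px ∷ Pps) with x ≟ᵇ s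
... | yes refl = f p Px ∷ All-tailsWithHead f Pps
... | no  _    = All-tailsWithHead f Pps

Unique-tailsWithHead : ∀ {n s} {ps : List (Subset (suc n))} → Unique ps → Unique (tailsWithHead s ps)
Unique-tailsWithHead                           []          = []
Unique-tailsWithHead {s = s} {(x ∷ p) ∷ _} (p∉ ∷ !ps) with x ≟ᵇ s
... | yes refl = All-tailsWithHead (λ q x∷p≢x∷q p≡q → x∷p≢x∷q (cong (x ∷_) p≡q)) p∉ ∷ Unique-tailsWithHead !ps
... | no  _    = Unique-tailsWithHead !ps

length≡length-tailsWithHead-outside : ∀ {n ℓ} {P : Pred (Subset (suc n)) ℓ} → (∀ p → ¬ P (inside ∷ p)) →
  ∀ {As} → All P As → length As ≡ length (tailsWithHead outside As)
length≡length-tailsWithHead-outside ¬P[inside∷] {As} PAs = begin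
  length As                                                            ≡⟨ length≡length-tailsWithHead As ⟩
  length (tailsWithHead outside As) + length (tailsWithHead inside As)
    ≡⟨ cong (length (tailsWithHead outside As) +_) (none (All-tailsWithHead ¬P[inside∷] PAs)) ⟩
  length (tailsWithHead outside As) + 0                                ≡⟨ +-identityʳ _ ⟩
  length (tailsWithHead outside As)                                    ∎
  where
  open ≡-Reasoning
  none : ∀ {xs : List (Subset _)} → All (λ _ → ⊥) xs → length xs ≡ 0
  none [] = refl

length≤∣p∣Ck : ∀ {n} (p : Subset n) k {As} → Unique As →
  All (λ A → A ⊆ p × ∣ A ∣ ≡ k) As → length As ≤ ∣ p ∣ C k
length≤∣p∣Ck []            k       {[]}          _                _                = z≤n
length≤∣p∣Ck []            k       {[] ∷ []}     _                ((_ , refl) ∷ []) = ≤-refl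
length≤∣p∣Ck []            k       {[] ∷ [] ∷ _} ((≢[] ∷ _) ∷ _) _                = contradiction refl ≢[]
length≤∣p∣Ck (outside ∷ p) k       !As As⊆ = ≤-trans
  (≤-reflexive (length≡length-tailsWithHead-outside (λ _ (in⊆out , _) → case in⊆out hereᵥ of λ ()) As⊆))
  (length≤∣p∣Ck p k (Unique-tailsWithHead !As) (All-tailsWithHead (λ _ (⊆ , ∣∣) → drop-∷-⊆ ⊆ , ∣∣) As⊆))
length≤∣p∣Ck (inside ∷ p) zero    !As As⊆ = ≤-trans
  (≤-reflexive (length≡length-tailsWithHead-outside (λ { _ (_ , ()) }) As⊆))
  (length≤∣p∣Ck p zero (Unique-tailsWithHead !As) (All-tailsWithHead (λ _ (⊆ , ∣∣) → drop-∷-⊆ ⊆ , ∣∣) As⊆))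
length≤∣p∣Ck (inside ∷ p) (suc k) {As} !As As⊆ = begin
  length As                                                          ≡⟨ length≡length-tailsWithHead As ⟩
  length (tailsWithHead outside As) + length (tailsWithHead inside As)
    ≤⟨ +-mono-≤ (length≤∣p∣Ck p (suc k) (Unique-tailsWithHead !As)
                   (All-tailsWithHead (λ _ (⊆ , ∣∣) → drop-∷-⊆ ⊆ , ∣∣) As⊆))
                (length≤∣p∣Ck p k (Unique-tailsWithHead !As)
                   (All-tailsWithHead (λ _ (⊆ , ∣∣) → drop-∷-⊆ ⊆ , suc-injective ∣∣) As⊆)) ⟩
  ∣ p ∣ C suc k + ∣ p ∣ C k                                          ≡⟨ +-comm (∣ p ∣ C suc k) _ ⟩
  ∣ p ∣ C k + ∣ p ∣ C suc k                                          ≡⟨ nCk+nC[k+1]≡[n+1]C[k+1] ∣ p ∣ k ⟩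
  suc ∣ p ∣ C suc k                                                  ∎
  where open ≤-Reasoning

length≤sumBelow[k]nC : ∀ {n} k {As : List (Subset n)} → Unique As →
  All (λ A → ∣ A ∣ < k) As → length As ≤ sumBelow k (n C_)
length≤sumBelow[k]nC         zero    {[]}          _               _        = z≤n
length≤sumBelow[k]nC         zero    {_ ∷ _}       _               (() ∷ _)
length≤sumBelow[k]nC {zero}  (suc k) {[]}          _               _        = z≤n
length≤sumBelow[k]nC {zero}  (suc k) {[] ∷ []}     _               _        = f0≤sumBelow[1+j]f (0 C_) k
length≤sumBelow[k]nC {zero}  (suc k) {[] ∷ [] ∷ _} ((≢[] ∷ _) ∷ _) _        = contradiction refl ≢[]
length≤sumBelow[k]nC {suc n} (suc k) {As}          !As             As<      = begin
  length As                                                            ≡⟨ length≡length-tailsWithHead As ⟩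
  length (tailsWithHead outside As) + length (tailsWithHead inside As)
    ≤⟨ +-mono-≤ (length≤sumBelow[k]nC (suc k) (Unique-tailsWithHead !As) (All-tailsWithHead (λ _ <k → <k) As<))
                (length≤sumBelow[k]nC k (Unique-tailsWithHead !As) (All-tailsWithHead (λ _ → s≤s⁻¹) As<)) ⟩
  sumBelow (suc k) (n C_) + sumBelow k (n C_)                          ≡⟨ sumBelow-pascal n k ⟨
  sumBelow (suc k) (suc n C_)                                          ∎
  where open ≤-Reasoning

length≤length*kCj : ∀ {n} k j (𝓖 : List (Subset n)) → All (λ G → ∣ G ∣ ≡ k) 𝓖 → ∀ {As} → Unique As →
  All (λ A → ∣ A ∣ ≡ j × Any (A ⊆_) 𝓖) As → length As ≤ length 𝓖 * (k C j)
length≤length*kCj k j 𝓖 uniform !As As⊆𝓖 = length≤length*bound (λ G A → (A ⊆? G) ×-dec (∣ A ∣ ≟ j)) 𝓖 (k C j)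
  (λ G∈ !Bs Bs⊆G → subst (λ m → _ ≤ m C j) (All.lookup uniform G∈) (length≤∣p∣Ck _ j !Bs Bs⊆G))
  !As (All.map (λ (∣A∣≡j , A⊆𝓖) → Any.map (_, ∣A∣≡j) A⊆𝓖) As⊆𝓖)

[1+n]Cn≡1+n : ∀ n → suc n C n ≡ suc n
[1+n]Cn≡1+n n = begin
  suc n C n           ≡⟨ nCk≡nC[n∸k] (n≤1+n n) ⟩
  suc n C (suc n ∸ n) ≡⟨ cong (suc n C_) (m+n∸n≡m 1 n) ⟩
  suc n C 1           ≡⟨ nC1≡n (suc n) ⟩
  suc n               ∎
  where open ≡-Reasoning

All-D : ∀ {n ℓ} {P : Pred (Subset n) ℓ} (𝓕 : Family n) →
  (∀ {F G} → F ∈ 𝓕 → G ∈ 𝓕 → P (F ─ G)) → All P (D 𝓕)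
All-D 𝓕 P[F─G] = All.deduplicate⁺ (≡-dec _≟ᵇ_)
  (All.concat⁺ (All.map⁺ (All.tabulate (λ F∈ → All.map⁺ (All.tabulate (λ G∈ → P[F─G] F∈ G∈))))))

Unique-D : ∀ {n} (𝓕 : Family n) → Unique (D 𝓕)
Unique-D 𝓕 = deduplicate-! (≡-dec _≟ᵇ_) _

proposition7 : (n k : ℕ) → 1 ≤ n → 1 ≤ k → 3 * k ≤ n →
  (𝓕 : Family n) → Unique 𝓕 → IsUniform k 𝓕 → IsIntersecting 𝓕 →
  2 * k * length 𝓕 ≤ (n ∸ 1) C (k ∸ 1) →
  length (D 𝓕) ≤ sumBelow k (λ ℓ → (n ∸ 1) C ℓ)
-- Repeated members of 𝓕 only strengthen the size hypothesis.
proposition7 (suc N) (suc K) _ _ 3k≤n 𝓕 _ uniform intersecting 2km≤C = begin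
  length (D 𝓕)                                       ≡⟨ length≡length-filter+length-filter-¬ ofSizeK? (D 𝓕) ⟩
  length (filter ofSizeK? (D 𝓕)) + length (filter (¬? ∘ ofSizeK?) (D 𝓕))
    ≤⟨ +-mono-≤ large small ⟩
  length 𝓕 * (suc K C K) + sumBelow K (suc N C_)     ≡⟨ cong (λ c → length 𝓕 * c + sumBelow K (suc N C_)) ([1+n]Cn≡1+n K) ⟩
  length 𝓕 * suc K + sumBelow K (suc N C_)
    ≤⟨ m*[1+k]+sumBelow[k][1+n]C≤sumBelow[1+k][n]C N K (length 𝓕) 3k≤n 2km≤C ⟩
  sumBelow (suc K) (N C_)                             ∎
  where
  open ≤-Reasoning
  differences : All (λ A → ∣ A ∣ < suc K × Any (A ⊆_) 𝓕) (D 𝓕)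
  differences = All-D 𝓕 λ {F} {G} F∈ G∈ →
    subst (∣ F ─ G ∣ <_) (All.lookup uniform F∈) (p∩q≢∅⇒∣p─q∣<∣p∣ F G (intersecting F∈ G∈)) ,
    Any.map (λ { refl x∈F─G → p─q⊆p F G x∈F─G }) F∈
  ofSizeK? : Decidable (λ A → ∣ A ∣ ≡ K)
  ofSizeK? A = ∣ A ∣ ≟ K
  large : length (filter ofSizeK? (D 𝓕)) ≤ length 𝓕 * (suc K C K)
  large = length≤length*kCj (suc K) K 𝓕 uniform (Unique.filter⁺ ofSizeK? (Unique-D 𝓕))
    (All.zipWith (λ (∣A∣≡K , _ , A⊆𝓕) → ∣A∣≡K , A⊆𝓕) (All.all-filter ofSizeK? (D 𝓕) , All.filter⁺ ofSizeK? differences))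
  small : length (filter (¬? ∘ ofSizeK?) (D 𝓕)) ≤ sumBelow K (suc N C_)
  small = length≤sumBelow[k]nC K (Unique.filter⁺ (¬? ∘ ofSizeK?) (Unique-D 𝓕))
    (All.zipWith (λ (∣A∣≢K , ∣A∣<1+K , _) → ≤∧≢⇒< (s≤s⁻¹ ∣A∣<1+K) ∣A∣≢K)
      (All.all-filter (¬? ∘ ofSizeK?) (D 𝓕) , All.filter⁺ (¬? ∘ ofSizeK?) differences))
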